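{- Let $\ell\ge 2$, let $\mathbf{a}=(a_1,\ldots,a_\ell)\in\mathbf{Z}^\ell$ with $\sum_j a_j=0$, and let $\lambda=\pi(\mathbf{a})$. Let $i$ be the largest index with $a_i=\max\{a_1,\ldots,a_\ell\}$. Then \[ \lambda_1=(a_i-1)\ell+i \] and \[ \lambda_1=\sum_{j=1}^{i-1}(a_i-a_j)+\sum_{j=i+1}^{\ell}(a_i-a_j-1). \]
   Context: $\lambda_1$ denotes the first (largest) part of $\lambda$ (zero for the empty partition). For $\mathbf{a}\in\mathbf{Z}^\ell$ with $\sum a_j=0$, let $X(\mathbf{a})=\{r\ell+(j-1):1\le j\le\ell,\ r\in\mathbf{Z},\ r\le a_j\}$ (balanced flush abacus: runner $j-1$ filled with beads down to level $a_j$), and let $\pi(\mathbf{a})$ be the partition whose parts are the nonzero values of $|\{y\in\mathbf{Z}\setminus X(\mathbf{a}):y<x\}|$ for $x\in X(\mathbf{a})$; $\pi$ is a bijection onto the $\ell$-cores (partitions with no hook length divisible by $\ell$). -}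

module Defs where

open import Data.Nat using (ℕ; zero; suc; _<?_)
open import Data.Integer using (ℤ; +_; _+_; _*_; _≤_; _<_)
open import Data.Fin using (Fin; toℕ)
open import Data.List using (List; length)
open import Data.List.Membership.Propositional using (_∈_)
open import Data.List.Relation.Unary.Unique.Propositional using (Unique)
open import Data.Product using (Σ; _×_; ∃-syntax)
open import Data.Sum using (_⊎_)
open import Function.Bundles using (_⇔_)
open import Relation.Binary.PropositionalEquality using (_≡_)
open import Relation.Nullary using (¬_)
open import Relation.Nullary.Decidable using (⌊_⌋)
open import Data.Bool using (if_then_else_)

sumFin : (n : ℕ) → (Fin n → ℤ) → ℤ
sumFin zero    f = + 0
sumFin (suc n) f = f Fin.zero + sumFin n (λ j → f (Fin.suc j))
  where import Data.Fin as Fin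

sumBelow : (n : ℕ) → ℕ → (Fin n → ℤ) → ℤ
sumBelow n k f = sumFin n (λ j → if ⌊ toℕ j <? k ⌋ then f j else + 0)

sumAbove : (n : ℕ) → ℕ → (Fin n → ℤ) → ℤ
sumAbove n k f = sumFin n (λ j → if ⌊ k <? toℕ j ⌋ then f j else + 0)

-- Balanced flush abacus X(a).  Runner index j : Fin ℓ stands for the
-- paper's runner j' - 1 where j' = toℕ j + 1 ∈ {1,…,ℓ}.
-- x ∈ X(a)  iff  x = r ℓ + (j'-1) with r ≤ a_{j'}.
InX : (ℓ : ℕ) → (Fin ℓ → ℤ) → ℤ → Set
InX ℓ a x = Σ (Fin ℓ) λ j → Σ ℤ λ r → (r ≤ a j) × (x ≡ r * + ℓ + + toℕ j)

GapCount : (ℓ : ℕ) → (Fin ℓ → ℤ) → ℤ → ℕ → Set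
GapCount ℓ a x n =
  Σ (List ℤ) λ ys → Unique ys × (∀ y → (y ∈ ys) ⇔ ((y < x) × ¬ InX ℓ a y))
                  × (length ys ≡ n)

-- m is a part of π(a): a nonzero value of the gap count at some x ∈ X(a).
IsPart : (ℓ : ℕ) → (Fin ℓ → ℤ) → ℕ → Set
IsPart ℓ a m = (¬ m ≡ 0) × ∃[ x ] (InX ℓ a x × GapCount ℓ a x m)

-- m = λ₁ for λ = π(a): m is the largest part (0 if there are no parts).
IsFirstPart : (ℓ : ℕ) → (Fin ℓ → ℤ) → ℕ → Set
IsFirstPart ℓ a m =
  (∀ n → IsPart ℓ a n → n Data.Nat.≤ m) × ((m ≡ 0) ⊎ IsPart ℓ a m)
  where import Data.Nat

-- Let M = a_i ℓ + (i - 1) be the largest bead of X(a).  A bead x ≤ M has no more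
-- gaps below it than M has, so λ₁ is the number of gaps below M.  Runner j - 1 has
-- a gap at level r below M exactly when a_j < r ≤ c_j, where c_j = a_i for j ≤ i
-- and c_j = a_i - 1 for j > i (as a_j < a_i there).  Hence λ₁ = Σ_j (c_j - a_j),
-- which is the second formula, and with Σ_j a_j = 0 it equals
-- ℓ a_i - (ℓ - i) = (a_i - 1) ℓ + i.

module Submission where

open import Defs
open import Data.Nat using (ℕ; suc)
open import Data.Integer using (ℤ; +_; _+_; _-_; _*_; _≤_; _<_)
open import Data.Fin using (Fin; toℕ)
open import Data.Product using (_×_; ∃-syntax)
open import Relation.Binary.PropositionalEquality using (_≡_)

open import Data.Bool using (if_then_else_)
open import Data.Empty using (⊥-elim)
import Data.Fin as Fin
import Data.Fin.Properties as Finₚ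
import Data.Integer as ℤ
open import Data.Integer using (+[1+_]; -[1+_]; -_; ∣_∣; +≤+; +<+; _/ℕ_; _%ℕ_)
open import Data.Integer.DivMod using (n%ℕd<d; a≡a%ℕn+[a/ℕn]*n)
open import Data.Integer.Properties hiding (_≤?_; _<?_)
open import Algebra.Properties.AbelianGroup +-0-abelianGroup using (∙-cancelˡ)
open import Data.Integer.Tactic.RingSolver using (solve-∀)
open import Data.List using (List; []; _∷_; _++_; [_]; length; map; concat; tabulate; upTo)
open import Data.List.Membership.Propositional using (_∈_)
open import Data.List.Membership.Propositional.Properties
  using (∈-map⁺; ∈-map⁻; ∈-upTo⁺; ∈-upTo⁻; ∈-concat⁺; ∈-concat⁻; ∈-∃++; ∈-++⁺ˡ; ∈-++⁺ʳ; ∈-++⁻)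
open import Data.List.Properties using (length-++; length-map; length-upTo)
open import Data.List.Relation.Binary.Disjoint.Propositional using (Disjoint)
open import Data.List.Relation.Binary.Subset.Propositional using (_⊆_)
import Data.List.Relation.Unary.All as All
import Data.List.Relation.Unary.All.Properties as Allₚ
open import Data.List.Relation.Unary.AllPairs using (_∷_)
import Data.List.Relation.Unary.AllPairs.Properties as AllPairsₚ
open import Data.List.Relation.Unary.Any using (here; there)
import Data.List.Relation.Unary.Any.Properties as Anyₚ
open import Data.List.Relation.Unary.Unique.Propositional using (Unique)
import Data.List.Relation.Unary.Unique.Propositional.Properties as Uniqueₚ
import Data.Nat as ℕ
open import Data.Nat using (zero; _∸_; _<?_; NonZero; z≤n; s≤s)
import Data.Nat.Properties as ℕₚ
open import Data.Product using (_,_; proj₁; proj₂; uncurry)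
open import Data.Sum using (_⊎_; inj₁; inj₂)
open import Function.Bundles using (_⇔_; mk⇔; Equivalence)
open import Relation.Binary.Definitions using (tri<; tri≈; tri>)
open import Relation.Binary.PropositionalEquality
  using (_≢_; refl; sym; trans; cong; cong₂; subst; module ≡-Reasoning)
open import Relation.Nullary using (¬_; yes; no; contradiction)
open import Relation.Nullary.Decidable using (⌊_⌋)

sumFin-cong : ∀ n {f g : Fin n → ℤ} → (∀ j → f j ≡ g j) → sumFin n f ≡ sumFin n g
sumFin-cong zero    f≗g = refl
sumFin-cong (suc n) f≗g = cong₂ _+_ (f≗g Fin.zero) (sumFin-cong n (λ j → f≗g (Fin.suc j)))

sumFin-+ : ∀ n (f g : Fin n → ℤ) → sumFin n (λ j → f j + g j) ≡ sumFin n f + sumFin n g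
sumFin-+ zero    f g = refl
sumFin-+ (suc n) f g =
  trans (cong (_+_ (f Fin.zero + g Fin.zero)) (sumFin-+ n (λ j → f (Fin.suc j)) (λ j → g (Fin.suc j))))
        (interchange (f Fin.zero) (g Fin.zero) _ _)
  where
  interchange : ∀ a b c d → (a + b) + (c + d) ≡ (a + c) + (b + d)
  interchange = solve-∀

sumFin-minus : ∀ n (f g : Fin n → ℤ) → sumFin n (λ j → f j - g j) ≡ sumFin n f - sumFin n g
sumFin-minus zero    f g = refl
sumFin-minus (suc n) f g =
  trans (cong (_+_ (f Fin.zero - g Fin.zero)) (sumFin-minus n (λ j → f (Fin.suc j)) (λ j → g (Fin.suc j))))
        (interchange (f Fin.zero) (g Fin.zero) _ _)
  where
  interchange : ∀ a b c d → (a - b) + (c - d) ≡ (a + c) - (b + d)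
  interchange = solve-∀

sumFin-const : ∀ n c → sumFin n (λ _ → c) ≡ c * + n
sumFin-const zero    c = sym (*-zeroʳ c)
sumFin-const (suc n) c = trans (cong (_+_ c) (sumFin-const n c)) (distrib c (+ n))
  where
  distrib : ∀ c n → c + c * n ≡ c * (+ 1 + n)
  distrib = solve-∀

sumAbove-one : ∀ n k → sumAbove n k (λ _ → + 1) ≡ + (n ∸ suc k)
sumAbove-one zero    k       = refl
sumAbove-one (suc n) zero    = trans (+-identityˡ _) (trans (sumFin-const n (+ 1)) (*-identityˡ (+ n)))
sumAbove-one (suc n) (suc k) =
  trans (+-identityˡ _) (trans (sumFin-cong n shift) (sumAbove-one n k))
  where
  shift : ∀ j → (if ⌊ suc k <? suc (toℕ j) ⌋ then + 1 else + 0) ≡ (if ⌊ k <? toℕ j ⌋ then + 1 else + 0)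
  shift j with suc k <? suc (toℕ j) | k <? toℕ j
  ... | yes _   | yes _   = refl
  ... | no _    | no _    = refl
  ... | yes k<j | no k≮j  = contradiction (ℕ.s<s⁻¹ k<j) k≮j
  ... | no k≮j  | yes k<j = contradiction (ℕ.s<s k<j) k≮j

module _ {a} {A : Set a} where

  unique-⊆⇒length-≤ : {xs ys : List A} → Unique xs → xs ⊆ ys → length xs ℕ.≤ length ys
  unique-⊆⇒length-≤ {[]}     _           _   = z≤n
  unique-⊆⇒length-≤ {x ∷ xs} (x∉xs ∷ xs-unique) xs⊆ys with ∈-∃++ (xs⊆ys (here refl))
  ... | ws , zs , refl = subst (suc (length xs) ℕ.≤_) (sym (length-middle ws zs))
                           (s≤s (unique-⊆⇒length-≤ xs-unique xs⊆ws++zs))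
    where
    length-middle : ∀ ws zs → length (ws ++ [ x ] ++ zs) ≡ suc (length (ws ++ zs))
    length-middle ws zs = trans (length-++ ws) (trans (ℕₚ.+-suc (length ws) (length zs))
                                                      (cong suc (sym (length-++ ws))))
    xs⊆ws++zs : xs ⊆ ws ++ zs
    xs⊆ws++zs {y} y∈xs with ∈-++⁻ ws (xs⊆ys (there y∈xs))
    ... | inj₁ y∈ws         = ∈-++⁺ˡ y∈ws
    ... | inj₂ (here refl)  = ⊥-elim (All.lookup x∉xs y∈xs refl)
    ... | inj₂ (there y∈zs) = ∈-++⁺ʳ ws y∈zs

  length-concat-tabulate : ∀ n (R : Fin n → List A) →
    + length (concat (tabulate R)) ≡ sumFin n (λ j → + length (R j))
  length-concat-tabulate zero    R = refl
  length-concat-tabulate (suc n) R =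
    trans (cong +_ (length-++ (R Fin.zero)))
          (cong (_+_ (+ length (R Fin.zero))) (length-concat-tabulate n (λ j → R (Fin.suc j))))

  ∈-concat-tabulate⁻ : ∀ {n} (R : Fin n → List A) {y} → y ∈ concat (tabulate R) → ∃[ j ] y ∈ R j
  ∈-concat-tabulate⁻ R y∈ = Anyₚ.tabulate⁻ (∈-concat⁻ (tabulate R) y∈)

  ∈-concat-tabulate⁺ : ∀ {n} (R : Fin n → List A) {y} j → y ∈ R j → y ∈ concat (tabulate R)
  ∈-concat-tabulate⁺ R j y∈ = ∈-concat⁺ (Anyₚ.tabulate⁺ j y∈)

i+[j-i]≡j : ∀ i j → i + (j - i) ≡ j
i+[j-i]≡j = solve-∀

i≤j-1⇔i<j : ∀ {i j} → i ≤ j - + 1 ⇔ i < j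
i≤j-1⇔i<j {i} {j} = subst (λ k → i ≤ k ⇔ i < j) (+-comm (- + 1) j) (mk⇔ i≤pred[j]⇒i<j i<j⇒i≤pred[j])

levelsAbove : ℤ → ℕ → List ℤ
levelsAbove lo n = map (λ k → lo + +[1+ k ]) (upTo n)

length-levelsAbove : ∀ lo n → length (levelsAbove lo n) ≡ n
length-levelsAbove lo n = trans (length-map _ (upTo n)) (length-upTo n)

levelsAbove-unique : ∀ lo n → Unique (levelsAbove lo n)
levelsAbove-unique lo n = Uniqueₚ.map⁺ injective (Uniqueₚ.upTo⁺ n)
  where
  injective : ∀ {k m} → lo + +[1+ k ] ≡ lo + +[1+ m ] → k ≡ m
  injective eq with ∙-cancelˡ lo _ _ eq
  ... | refl = refl

<⇒≡+[1+] : ∀ {lo r} → lo < r → ∃[ k ] r ≡ lo + +[1+ k ]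
<⇒≡+[1+] {lo} {r} lo<r with r - lo in eq | i≤j⇒0≤j-i (<⇒≤ lo<r)
... | +[1+ k ] | _ = k , trans (sym (i+[j-i]≡j lo r)) (cong (_+_ lo) eq)
... | + zero   | _ = ⊥-elim (<⇒≢ lo<r (sym (i-j≡0⇒i≡j r lo eq)))
... | -[1+ _ ] | ()

∈-levelsAbove⁻ : ∀ {lo n r} → r ∈ levelsAbove lo n → lo < r × r ≤ lo + + n
∈-levelsAbove⁻ {lo} r∈ with ∈-map⁻ _ r∈
... | k , k∈ , refl = i<i+j , +-monoʳ-≤ lo (+≤+ (∈-upTo⁻ k∈))
  where
  i<i+j : lo < lo + +[1+ k ]
  i<i+j = subst (_< lo + +[1+ k ]) (+-identityʳ lo) (+-monoʳ-< lo (+<+ (s≤s z≤n)))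

∈-levelsAbove⁺ : ∀ {lo n r} → lo < r → r ≤ lo + + n → r ∈ levelsAbove lo n
∈-levelsAbove⁺ {lo} {n} lo<r r≤ with <⇒≡+[1+] lo<r
... | k , refl = ∈-map⁺ _ (∈-upTo⁺ (ℕₚ.≰⇒> (λ n≤k → <⇒≱ (+-monoʳ-< lo (+<+ (s≤s n≤k))) r≤)))

module Positions (ℓ : ℕ) where

  position : ℤ → Fin ℓ → ℤ
  position r j = r * + ℓ + + toℕ j

  position-<-level : ∀ {r s} (j k : Fin ℓ) → r < s → position r j < position s k
  position-<-level {r} {s} j k r<s = begin-strict
    r * + ℓ + + toℕ j  <⟨ +-monoʳ-< (r * + ℓ) (+<+ (Finₚ.toℕ<n j)) ⟩
    r * + ℓ + + ℓ      ≡⟨ trans (+-comm (r * + ℓ) (+ ℓ)) (sym (suc-* r (+ ℓ))) ⟩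
    ℤ.suc r * + ℓ      ≤⟨ *-monoʳ-≤-nonNeg (+ ℓ) (i<j⇒suc[i]≤j r<s) ⟩
    s * + ℓ            ≤⟨ i≤i+j (s * + ℓ) (+ toℕ k) ⟩
    s * + ℓ + + toℕ k  ∎
    where open ≤-Reasoning

  position-<-runner : ∀ {r s} (j k : Fin ℓ) → r ≤ s → j Fin.< k → position r j < position s k
  position-<-runner _ _ r≤s j<k = +-mono-≤-< (*-monoʳ-≤-nonNeg (+ ℓ) r≤s) (+<+ j<k)

  position-mono-≤ : ∀ {r s} (j k : Fin ℓ) → r ≤ s → j Fin.≤ k → position r j ≤ position s k
  position-mono-≤ _ _ r≤s j≤k = +-mono-≤ (*-monoʳ-≤-nonNeg (+ ℓ) r≤s) (+≤+ j≤k)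

  position-injective : ∀ {r s} {j k : Fin ℓ} → position r j ≡ position s k → r ≡ s × j ≡ k
  position-injective {r} {s} {j} {k} eq with <-cmp r s
  ... | tri< r<s _ _ = contradiction eq (<⇒≢ (position-<-level j k r<s))
  ... | tri> _ _ s<r = contradiction (sym eq) (<⇒≢ (position-<-level k j s<r))
  ... | tri≈ _ refl _ with Finₚ.<-cmp j k
  ...   | tri< j<k _ _ = contradiction eq (<⇒≢ (position-<-runner j k (≤-refl {r}) j<k))
  ...   | tri> _ _ k<j = contradiction (sym eq) (<⇒≢ (position-<-runner k j (≤-refl {r}) k<j))
  ...   | tri≈ _ j≡k _ = refl , j≡k

  position-surjective : {{_ : NonZero ℓ}} → ∀ y → ∃[ j ] ∃[ r ] y ≡ position r j
  position-surjective y = Fin.fromℕ< y%ℓ<ℓ , y /ℕ ℓ , (begin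
    y                                  ≡⟨ a≡a%ℕn+[a/ℕn]*n y ℓ ⟩
    + (y %ℕ ℓ) + y /ℕ ℓ * + ℓ          ≡⟨ +-comm (+ (y %ℕ ℓ)) (y /ℕ ℓ * + ℓ) ⟩
    y /ℕ ℓ * + ℓ + + (y %ℕ ℓ)          ≡⟨ cong (λ t → y /ℕ ℓ * + ℓ + + t) (sym (Finₚ.toℕ-fromℕ< y%ℓ<ℓ)) ⟩
    position (y /ℕ ℓ) (Fin.fromℕ< y%ℓ<ℓ) ∎)
    where
    open ≡-Reasoning
    y%ℓ<ℓ : y %ℕ ℓ ℕ.< ℓ
    y%ℓ<ℓ = n%ℕd<d y ℓ

module MaximalBead (ℓ : ℕ) {{_ : NonZero ℓ}} (a : Fin ℓ → ℤ) (i : Fin ℓ)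
  (a≤aᵢ : ∀ j → a j ≤ a i) (a<aᵢ : ∀ j → i Fin.< j → a j < a i) where

  open Positions ℓ

  maxBead : ℤ
  maxBead = position (a i) i

  maxBead-∈X : InX ℓ a maxBead
  maxBead-∈X = i , a i , ≤-refl , refl

  rightIndicator : Fin ℓ → ℤ
  rightIndicator j = if ⌊ toℕ i <? toℕ j ⌋ then + 1 else + 0

  ceiling : Fin ℓ → ℤ
  ceiling j = a i - rightIndicator j

  ceiling-cases : ∀ j → (i Fin.< j × ceiling j ≡ a i - + 1) ⊎ (¬ i Fin.< j × ceiling j ≡ a i)
  ceiling-cases j with toℕ i <? toℕ j
  ... | yes i<j = inj₁ (i<j , refl)
  ... | no i≮j  = inj₂ (i≮j , +-identityʳ (a i))

  position-≤-maxBead⇔ : ∀ r j → position r j ≤ maxBead ⇔ r ≤ ceiling j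
  position-≤-maxBead⇔ r j with ceiling-cases j
  ... | inj₁ (i<j , c≡) rewrite c≡ = mk⇔
    (λ p≤M → Equivalence.from (i≤j-1⇔i<j {r} {a i})
                (≰⇒> (λ aᵢ≤r → <⇒≱ (position-<-runner i j aᵢ≤r i<j) p≤M)))
    (λ r≤aᵢ-1 → <⇒≤ (position-<-level j i (Equivalence.to (i≤j-1⇔i<j {r} {a i}) r≤aᵢ-1)))
  ... | inj₂ (i≮j , c≡) rewrite c≡ = mk⇔
    (λ p≤M → ≮⇒≥ (λ aᵢ<r → <⇒≱ (position-<-level i j aᵢ<r) p≤M))
    (λ r≤aᵢ → position-mono-≤ j i r≤aᵢ (ℕₚ.≮⇒≥ i≮j))

  a≤ceiling : ∀ j → a j ≤ ceiling j
  a≤ceiling j with ceiling-cases j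
  ... | inj₁ (i<j , c≡) rewrite c≡ = Equivalence.from (i≤j-1⇔i<j {a j} {a i}) (a<aᵢ j i<j)
  ... | inj₂ (_   , c≡) rewrite c≡ = a≤aᵢ j

  bead-≤-maxBead : ∀ {x} → InX ℓ a x → x ≤ maxBead
  bead-≤-maxBead (j , r , r≤a , refl) =
    Equivalence.from (position-≤-maxBead⇔ r j) (≤-trans r≤a (a≤ceiling j))

  depth : Fin ℓ → ℕ
  depth j = ∣ ceiling j - a j ∣

  +depth≡ceiling-a : ∀ j → + depth j ≡ ceiling j - a j
  +depth≡ceiling-a j = 0≤i⇒+∣i∣≡i (i≤j⇒0≤j-i (a≤ceiling j))

  ceiling≡a+depth : ∀ j → ceiling j ≡ a j + + depth j
  ceiling≡a+depth j = trans (sym (i+[j-i]≡j (a j) (ceiling j))) (cong (_+_ (a j)) (sym (+depth≡ceiling-a j)))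

  gapsOn : Fin ℓ → List ℤ
  gapsOn j = map (λ r → position r j) (levelsAbove (a j) (depth j))

  gaps : List ℤ
  gaps = concat (tabulate gapsOn)

  ∈-gapsOn⁻ : ∀ {j y} → y ∈ gapsOn j → ∃[ r ] (a j < r × r ≤ ceiling j × y ≡ position r j)
  ∈-gapsOn⁻ {j} y∈ with ∈-map⁻ _ y∈
  ... | r , r∈ , refl with ∈-levelsAbove⁻ r∈
  ... | a<r , r≤a+d = r , a<r , subst (r ≤_) (sym (ceiling≡a+depth j)) r≤a+d , refl

  ∈-gapsOn⁺ : ∀ {j r} → a j < r → r ≤ ceiling j → position r j ∈ gapsOn j
  ∈-gapsOn⁺ {j} {r} a<r r≤c = ∈-map⁺ _ (∈-levelsAbove⁺ a<r (subst (r ≤_) (ceiling≡a+depth j) r≤c))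

  ∈-gaps⁻ : ∀ {y} → y ∈ gaps → y < maxBead × ¬ InX ℓ a y
  ∈-gaps⁻ y∈ with ∈-concat-tabulate⁻ gapsOn y∈
  ... | j , y∈ⱼ with ∈-gapsOn⁻ y∈ⱼ
  ... | r , a<r , r≤c , refl = ≤∧≢⇒< (Equivalence.from (position-≤-maxBead⇔ r j) r≤c) y≢M , y∉X
    where
    y∉X : ¬ InX ℓ a (position r j)
    y∉X (k , s , s≤a , eq) with position-injective {r} {s} {j} {k} eq
    ... | refl , refl = <⇒≱ a<r s≤a
    y≢M : position r j ≢ maxBead
    y≢M y≡M = y∉X (subst (InX ℓ a) (sym y≡M) maxBead-∈X)

  ∈-gaps⁺ : ∀ {y} → y < maxBead → ¬ InX ℓ a y → y ∈ gaps
  ∈-gaps⁺ {y} y<M y∉X with position-surjective y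
  ... | j , r , refl = ∈-concat-tabulate⁺ gapsOn j (∈-gapsOn⁺ a<r r≤c)
    where
    a<r : a j < r
    a<r = ≰⇒> (λ r≤a → y∉X (j , r , r≤a , refl))
    r≤c : r ≤ ceiling j
    r≤c = Equivalence.to (position-≤-maxBead⇔ r j) (<⇒≤ y<M)

  gaps-unique : Unique gaps
  gaps-unique = Uniqueₚ.concat⁺ (Allₚ.tabulate⁺ gapsOn-unique) (AllPairsₚ.tabulate⁺ disjoint)
    where
    gapsOn-unique : ∀ j → Unique (gapsOn j)
    gapsOn-unique j = Uniqueₚ.map⁺ (λ {r} {s} eq → proj₁ (position-injective {r} {s} {j} {j} eq))
                                   (levelsAbove-unique (a j) (depth j))
    disjoint : ∀ {j k} → j ≢ k → Disjoint (gapsOn j) (gapsOn k)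
    disjoint {j} {k} j≢k (y∈ⱼ , y∈ₖ) with ∈-gapsOn⁻ y∈ⱼ | ∈-gapsOn⁻ y∈ₖ
    ... | r , _ , _ , refl | s , _ , _ , eq = j≢k (proj₂ (position-injective {r} {s} {j} {k} eq))

  maxBead-gapCount : GapCount ℓ a maxBead (length gaps)
  maxBead-gapCount = gaps , gaps-unique , (λ y → mk⇔ ∈-gaps⁻ (uncurry ∈-gaps⁺)) , refl

  part-≤ : ∀ n → IsPart ℓ a n → n ℕ.≤ length gaps
  part-≤ _ (_ , x , x∈X , ys , ys-unique , ys⇔ , refl) = unique-⊆⇒length-≤ ys-unique ys⊆gaps
    where
    ys⊆gaps : ys ⊆ gaps
    ys⊆gaps y∈ys with Equivalence.to (ys⇔ _) y∈ys
    ... | y<x , y∉X = ∈-gaps⁺ (<-≤-trans y<x (bead-≤-maxBead x∈X)) y∉X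

  isFirstPart : IsFirstPart ℓ a (length gaps)
  isFirstPart = part-≤ , zero-or-part
    where
    zero-or-part : length gaps ≡ 0 ⊎ IsPart ℓ a (length gaps)
    zero-or-part with length gaps ℕ.≟ 0
    ... | yes ≡0 = inj₁ ≡0
    ... | no ≢0  = inj₂ (≢0 , maxBead , maxBead-∈X , maxBead-gapCount)

  length-gaps : + length gaps ≡ sumFin ℓ (λ j → ceiling j - a j)
  length-gaps = trans (length-concat-tabulate ℓ gapsOn) (sumFin-cong ℓ λ j →
    trans (cong +_ (trans (length-map _ (levelsAbove (a j) (depth j))) (length-levelsAbove (a j) (depth j))))
          (+depth≡ceiling-a j))

  ceiling-a-split : ∀ j → ceiling j - a j
    ≡ (if ⌊ toℕ j <? toℕ i ⌋ then a i - a j else + 0) + (if ⌊ toℕ i <? toℕ j ⌋ then a i - a j - + 1 else + 0)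
  ceiling-a-split j with toℕ j <? toℕ i | toℕ i <? toℕ j
  ... | yes j<i | yes i<j = contradiction j<i (ℕₚ.<⇒≯ i<j)
  ... | yes _   | no _    = trans (cong (_- a j) (+-identityʳ (a i))) (sym (+-identityʳ (a i - a j)))
  ... | no _    | yes _   = shuffle (a i) (a j)
    where
    shuffle : ∀ x y → x - + 1 - y ≡ + 0 + (x - y - + 1)
    shuffle = solve-∀
  ... | no j≮i  | no i≮j  with Finₚ.toℕ-injective (ℕₚ.≤-antisym (ℕₚ.≮⇒≥ i≮j) (ℕₚ.≮⇒≥ j≮i))
  ...   | refl = trans (cong (_- a i) (+-identityʳ (a i))) (+-inverseʳ (a i))

  length-gaps-split : + length gaps
    ≡ sumBelow ℓ (toℕ i) (λ j → a i - a j) + sumAbove ℓ (toℕ i) (λ j → a i - a j - + 1)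
  length-gaps-split = trans length-gaps (trans (sumFin-cong ℓ ceiling-a-split) (sumFin-+ ℓ _ _))

  length-gaps-closed : sumFin ℓ a ≡ + 0 → + length gaps ≡ (a i - + 1) * + ℓ + + suc (toℕ i)
  length-gaps-closed Σa≡0 = begin
    + length gaps                                            ≡⟨ length-gaps ⟩
    sumFin ℓ (λ j → ceiling j - a j)                         ≡⟨ sumFin-minus ℓ ceiling a ⟩
    sumFin ℓ ceiling - sumFin ℓ a                            ≡⟨ cong₂ _-_ (sumFin-minus ℓ (λ _ → a i) rightIndicator) Σa≡0 ⟩
    sumFin ℓ (λ _ → a i) - sumAbove ℓ (toℕ i) (λ _ → + 1) - + 0
      ≡⟨ cong₂ (λ s t → s - t - + 0) (sumFin-const ℓ (a i)) (trans (sumAbove-one ℓ (toℕ i)) ℓ∸1+i) ⟩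
    a i * + ℓ - (+ ℓ - + suc (toℕ i)) - + 0                 ≡⟨ rearrange (a i) (+ ℓ) (+ suc (toℕ i)) ⟩
    (a i - + 1) * + ℓ + + suc (toℕ i)                        ∎
    where
    open ≡-Reasoning
    ℓ∸1+i : + (ℓ ∸ suc (toℕ i)) ≡ + ℓ - + suc (toℕ i)
    ℓ∸1+i = sym (trans (m-n≡m⊖n ℓ (suc (toℕ i))) (⊖-≥ (Finₚ.toℕ<n i)))
    rearrange : ∀ x l m → x * l - (l - m) - + 0 ≡ (x - + 1) * l + m
    rearrange = solve-∀

proposition3p14 : (ℓ : ℕ) → 2 Data.Nat.≤ ℓ → (a : Fin ℓ → ℤ) → sumFin ℓ a ≡ + 0
    → (i : Fin ℓ) → (∀ j → a j ≤ a i) → (∀ j → toℕ i Data.Nat.< toℕ j → a j < a i)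
    → ∃[ m ] (IsFirstPart ℓ a m
      × (+ m ≡ (a i - + 1) * + ℓ + + suc (toℕ i))
      × (+ m ≡ sumBelow ℓ (toℕ i) (λ j → a i - a j) + sumAbove ℓ (toℕ i) (λ j → a i - a j - + 1)))
proposition3p14 (suc ℓ) (s≤s _) a Σa≡0 i a≤aᵢ a<aᵢ =
  length gaps , isFirstPart , length-gaps-closed Σa≡0 , length-gaps-split
  where open MaximalBead (suc ℓ) a i a≤aᵢ a<aᵢ
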